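{- For each integer $\ell\ge1$, let $L_\ell^{\mathrm{trk}}=\{w\in\{0,1\}^*\mid |w|_0=|w|_1=2\ell,\ \exists k\in\{1,\dots,\ell\}:\ \delta_{k,k}^{2\ell}(w)\in\{0101,1010,0110,1001\}\}$. Then $L_\ell^{\mathrm{trk}}$ is $2\ell$-uniform and $\mathcal{G}_{L_\ell^{\mathrm{trk}}}$ is exactly the class of $\ell$-track graphs.
   Context: $|w|_a$ is the number of occurrences of letter $a$ in $w$; a binary word is $k$-uniform if it has exactly $k$ occurrences of $0$ and of $1$. For a $2\ell$-uniform binary word $w$ and $k\in\{1,\dots,\ell\}$, $\delta_{k,k}^{2\ell}(w)$ is the word obtained from $w$ by deleting all occurrences of $0$ except the $(2k-1)$-st and $2k$-th, and all occurrences of $1$ except the $(2k-1)$-st and $2k$-th. For a word $w$ and distinct letters $a,b$, $h_{a,b}(w)$ is obtained by replacing $a$ by $0$, $b$ by $1$ and deleting all other letters. For $L\subseteq\{0,1\}^*$ closed under exchanging $0$ and $1$ and a word $w$ with letter set $V$, $G(L,w)$ is the graph on $V$ where distinct $u,v$ are adjacent iff $h_{u,v}(w)\in L$; $\mathcal{G}_L$ is the class of graphs isomorphic to some $G(L,w)$. A graph is an $\ell$-track graph if each vertex $v$ can be assigned closed real intervals $I_1(v),\dots,I_\ell(v)$ (interval $I_i(v)$ lying on track $i$) such that distinct $u,v$ are adjacent iff $I_i(u)\cap I_i(v)\neq\emptyset$ for some $i\in\{1,\dots,\ell\}$.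
   Formalization: The intervals assigned to the vertices of an ℓ-track graph have rational endpoints instead of real ones. -}

module Defs where

open import Data.Nat using (ℕ; zero; suc; _*_; _∸_; _≡ᵇ_; _≤_)
open import Data.Bool using (Bool; true; false; if_then_else_; _∨_)
open import Data.List using (List; []; _∷_)
open import Data.List.Membership.Propositional using (_∈_)
open import Data.Fin using (Fin)
import Data.Fin as Fin
open import Data.Rational using (ℚ) renaming (_≤_ to _≤ℚ_)
open import Data.Product using (Σ; ∃; _×_; proj₁; proj₂)
open import Data.Sum using (_⊎_)
open import Relation.Nullary using (¬_; does)
open import Relation.Binary.PropositionalEquality using (_≡_; _≢_)
open import Function.Bundles using (_↔_; _⇔_; Inverse)

-- Binary words: letters are Bool, with false = 0 and true = 1.
BinWord : Set
BinWord = List Bool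

occ : Bool → BinWord → ℕ
occ b [] = zero
occ b (c ∷ w) = if does (c Data.Bool.≟ b) then suc (occ b w) else occ b w

IsUniformWord : ℕ → BinWord → Set
IsUniformWord k w = (occ false w ≡ k) × (occ true w ≡ k)

IsUniformLang : ℕ → (BinWord → Set) → Set
IsUniformLang k L = ∀ w → L w → IsUniformWord k w

-- δ^{2ℓ}_{k,k}(w): keep only the (2k-1)-st and 2k-th occurrences of 0 and of 1.
-- Auxiliary: c0, c1 are the numbers of 0s / 1s already read.
δaux : ℕ → ℕ → ℕ → BinWord → BinWord
δaux k c0 c1 [] = []
δaux k c0 c1 (false ∷ w) =
  if (suc c0 ≡ᵇ (2 * k ∸ 1)) ∨ (suc c0 ≡ᵇ (2 * k))
  then false ∷ δaux k (suc c0) c1 w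
  else δaux k (suc c0) c1 w
δaux k c0 c1 (true ∷ w) =
  if (suc c1 ≡ᵇ (2 * k ∸ 1)) ∨ (suc c1 ≡ᵇ (2 * k))
  then true ∷ δaux k c0 (suc c1) w
  else δaux k c0 (suc c1) w

δkk : ℕ → BinWord → BinWord
δkk k w = δaux k 0 0 w

TrackPatterns : List BinWord
TrackPatterns =
  (false ∷ true ∷ false ∷ true ∷ []) ∷
  (true ∷ false ∷ true ∷ false ∷ []) ∷
  (false ∷ true ∷ true ∷ false ∷ []) ∷
  (true ∷ false ∷ false ∷ true ∷ []) ∷ []

Ltrk : ℕ → BinWord → Set
Ltrk ℓ w =
  (occ false w ≡ 2 * ℓ) × (occ true w ≡ 2 * ℓ) ×
  (Σ ℕ λ k → (1 ≤ k) × (k ≤ ℓ) × (δkk k w ∈ TrackPatterns))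

h : ∀ {m} → Fin m → Fin m → List (Fin m) → BinWord
h a b [] = []
h a b (x ∷ w) =
  if does (x Fin.≟ a) then false ∷ h a b w
  else if does (x Fin.≟ b) then true ∷ h a b w
  else h a b w

record Graph : Set₁ where
  field
    n      : ℕ
    Adj    : Fin n → Fin n → Set
    sym    : ∀ {u v} → Adj u v → Adj v u
    irrefl : ∀ {u} → ¬ Adj u u
open Graph public

-- G ∈ 𝒢_L : G is isomorphic to G(L,w) for some word w.  The letter set of w
-- is (after renaming) Fin m, i.e. w ∈ (Fin m)* and every letter of Fin m occurs in w.
-- G(L,w) has adjacency: u ≢ v and h_{u,v}(w) ∈ L.
InClass : (BinWord → Set) → Graph → Set
InClass L G =
  Σ ℕ λ m → Σ (List (Fin m)) λ w →
    (∀ (x : Fin m) → x ∈ w) ×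
    Σ (Fin m ↔ Fin (n G)) λ f →
      ∀ (u v : Fin m) →
        ((u ≢ v) × L (h u v w)) ⇔ Adj G (Inverse.to f u) (Inverse.to f v)

record Interval : Set where
  constructor [_,_]⟨_⟩
  field
    lo hi : ℚ
    lo≤hi : lo ≤ℚ hi
open Interval public

Meets : Interval → Interval → Set
Meets I J = Σ ℚ λ x → (lo I ≤ℚ x) × (x ≤ℚ hi I) × (lo J ≤ℚ x) × (x ≤ℚ hi J)

IsTrackGraph : ℕ → Graph → Set
IsTrackGraph ℓ G =
  Σ (Fin ℓ → Fin (n G) → Interval) λ I →
    ∀ (u v : Fin (n G)) → u ≢ v →
      (Adj G u v ⇔ (Σ (Fin ℓ) λ i → Meets (I i u) (I i v)))

-- For a 2ℓ-uniform binary word, δ^{2ℓ}_{k,k} keeps occurrences 2k-1 and 2k of each letter, and the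
-- result lies in {0101, 1010, 0110, 1001} exactly when the span of those two 0s overlaps the span
-- of those two 1s.  Hence, taking positions in a word w as coordinates and giving each letter x
-- that occurs 2ℓ times the interval between its occurrences 2k-1 and 2k on track k, h_{x,y}(w) lies
-- in L^trk_ℓ iff the intervals of x and y meet on some track; letters occurring a different number
-- of times are isolated, and get pairwise distinct points beyond the word.  Conversely, sorting the
-- endpoints on each track (left before right at equal coordinates) and concatenating the ℓ
-- resulting vertex sequences gives a word in which every vertex occurs twice per track, and
-- δ_{k,k} of h_{u,v} is the pattern of u and v on track k, which interleaves iff their intervals meet.
module Submission where

open import Defs
open import Data.Nat using (ℕ; _≤_; _*_)
open import Data.Product using (_×_)
open import Function.Bundles using (_⇔_)

open import Data.Bool using (Bool; true; false; not; _∨_; if_then_else_; f≤t)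
import Data.Bool.Properties as Bool
open import Data.Empty using (⊥; ⊥-elim)
open import Data.Fin using (Fin; toℕ; fromℕ<)
import Data.Fin as Fin
open import Data.Fin.Properties using (toℕ<n; toℕ-fromℕ<; toℕ-injective)
import Data.Integer as ℤ
import Data.Integer.Properties as ℤ
open import Data.List using (List; []; _∷_; _++_; map; length; filter; concat; concatMap; tabulate; allFin)
open import Data.List.Membership.Propositional using (_∈_)
open import Data.List.Membership.Propositional.Properties
  using (∈-map⁺; ∈-++⁺ˡ; ∈-allFin; ∈-concatMap⁺)
open import Data.List.Properties using (filter-accept; filter-reject; filter-none; concat-map; map-tabulate)
open import Data.List.Relation.Binary.Permutation.Propositional using (↭-sym)
open import Data.List.Relation.Binary.Permutation.Propositional.Properties using (∈-resp-↭)
import Data.List.Relation.Unary.All as All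
import Data.List.Relation.Unary.All.Properties as All
import Data.List.Relation.Unary.Any as Any
open import Data.List.Relation.Unary.Any using (here; there)
import Data.List.Relation.Unary.Linked as Linked
open import Data.List.Relation.Unary.Linked.Properties using (Linked⇒All)
import Data.List.Relation.Unary.Sorted.TotalOrder as Sorted
open import Data.List.Relation.Unary.Unique.Propositional using (Unique; _∷_)
open import Data.List.Relation.Unary.Unique.Propositional.Properties using (allFin⁺)
import Data.List.Sort.InsertionSort as InsertionSort
import Data.List.Sort.InsertionSort.Properties as InsertionSortₚ
open import Data.Nat using (zero; suc; _+_; _<_; _≡ᵇ_; _∸_; z≤n; s≤s; z<s; s<s; s<s⁻¹)
open import Data.Nat.Properties
  using ( +-identityʳ; +-suc; +-comm; *-suc; +-mono-≤; +-cancelˡ-≡; ≡ᵇ⇒≡; ≡⇒≡ᵇ; _≟_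
        ; ≤-refl; ≤-trans; ≤-reflexive; ≤-antisym; <-trans; <-≤-trans; <⇒≤; <⇒≢; >⇒≢; <⇒≱
        ; ≮⇒≥; ≤⇒≯; n<1+n; m<m+n; m≤m+n; m<n⇒m<1+n; m≤n⇒m≤1+n; m≤n⇒∃[o]m+o≡n
        ; module ≤-Reasoning )
import Data.Nat.Coprimality as Coprime
open import Data.Product using (Σ; ∃; _,_; proj₁; proj₂; swap)
import Data.Product.Function.Dependent.Propositional as Σ
open import Data.Product.Function.NonDependent.Propositional using (_×-⇔_)
import Data.Product.Relation.Binary.Lex.NonStrict as Lex
open import Data.Rational using (ℚ; mkℚ)
import Data.Rational as ℚ
import Data.Rational.Properties as ℚ
open import Data.Sum using (_⊎_; inj₁; inj₂; [_,_])
import Data.Sum as Sum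
open import Data.Unit using (⊤; tt)
open import Function.Base using (id; _∘_)
open import Function.Bundles using (mk⇔; Equivalence; Inverse)
open import Function.Construct.Composition using (_⇔-∘_)
open import Function.Construct.Identity using (⇔-id; ↔-id)
open import Function.Construct.Symmetry using (⇔-sym)
open import Function.Properties.Equivalence using (⇔-setoid)
open import Function.Related.Propositional using (equivalence)
open import Function.Related.TypeIsomorphisms using (¬-cong-⇔)
open import Level using (0ℓ)
import Relation.Binary.Construct.On as On
open import Relation.Binary.Bundles using (DecTotalOrder)
open import Relation.Binary.Definitions using (DecidableEquality) renaming (Decidable to Decidable₂)
import Relation.Binary.Properties.DecTotalOrder as DecTotalOrderProperties
open import Relation.Binary.PropositionalEquality
  using (_≡_; _≢_; refl; cong; cong₂; trans; subst; subst₂; ≢-sym; module ≡-Reasoning)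
import Relation.Binary.PropositionalEquality as ≡
import Relation.Binary.Reasoning.Setoid as SetoidReasoning
open import Relation.Nullary using (¬_; Dec; does; yes; no)
open import Relation.Nullary.Decidable using (_⊎-dec_)
open import Relation.Unary using (Pred; Decidable)

module ⇔-Reasoning = SetoidReasoning (⇔-setoid 0ℓ)

∃-cong : ∀ {a} {I : Set a} {A B : I → Set} → (∀ {i} → A i ⇔ B i) → ∃ A ⇔ ∃ B
∃-cong = Σ.congˡ {k = equivalence}

module _ {a p} {A : Set a} {P : Pred A p} (P? : Decidable P) where

  filter-unique : ∀ {x W} → Unique W → x ∈ W → P x → (∀ {z} → z ∈ W → P z → z ≡ x) →
    filter P? W ≡ x ∷ []
  filter-unique (x≢ ∷ _) (here refl) px only =
    trans (filter-accept P? px) (cong (_ ∷_) (filter-none P? (All.tabulate λ z∈ pz →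
      All.lookup x≢ z∈ (≡.sym (only (there z∈) pz)))))
  filter-unique (z≢ ∷ W!) (there x∈) px only =
    trans (filter-reject P? (λ pz → All.lookup z≢ x∈ (only (here refl) pz)))
          (filter-unique W! x∈ px (only ∘ there))

module _ {a} {A : Set a} (_≟ᴬ_ : DecidableEquality A) where

  oneOf? : ∀ u v → Decidable (λ z → z ≡ u ⊎ z ≡ v)
  oneOf? u v z = z ≟ᴬ u ⊎-dec z ≟ᴬ v

  filter-oneOf : ∀ {u v W} → Unique W → u ∈ W → v ∈ W → u ≢ v →
    filter (oneOf? u v) W ≡ u ∷ v ∷ [] ⊎ filter (oneOf? u v) W ≡ v ∷ u ∷ []
  filter-oneOf (_ ∷ _) (here refl) (here refl) u≢v = ⊥-elim (u≢v refl)
  filter-oneOf (u≢ ∷ W!) (here refl) (there v∈) _ =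
    inj₁ (trans (filter-accept (oneOf? _ _) (inj₁ refl)) (cong (_ ∷_) (filter-unique (oneOf? _ _) W! v∈ (inj₂ refl)
      λ z∈ → [ (λ z≡u → ⊥-elim (All.lookup u≢ z∈ (≡.sym z≡u))) , id ])))
  filter-oneOf (v≢ ∷ W!) (there u∈) (here refl) _ =
    inj₂ (trans (filter-accept (oneOf? _ _) (inj₂ refl)) (cong (_ ∷_) (filter-unique (oneOf? _ _) W! u∈ (inj₁ refl)
      λ z∈ → [ id , (λ z≡v → ⊥-elim (All.lookup v≢ z∈ (≡.sym z≡v))) ])))
  filter-oneOf {u} {v} {z ∷ W} (z≢ ∷ W!) (there u∈) (there v∈) u≢v =
    Sum.map (trans z-rejected) (trans z-rejected) (filter-oneOf W! u∈ v∈ u≢v)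
    where
    z-rejected : filter (oneOf? u v) (z ∷ W) ≡ filter (oneOf? u v) W
    z-rejected = filter-reject (oneOf? u v) [ All.lookup z≢ u∈ , All.lookup z≢ v∈ ]

module _ {a ℓ₁ ℓ₂ p} (O : DecTotalOrder a ℓ₁ ℓ₂)
         {P : Pred (DecTotalOrder.Carrier O) p} (P? : Decidable P) where

  open DecTotalOrder O using (_≤?_; totalOrder) renaming (_≤_ to _≤ₒ_; trans to ≤ₒ-trans)
  open InsertionSort O using (insert; sort)
  open InsertionSortₚ O using (sort-↗)
  open Sorted totalOrder using (Sorted)

  insert-≤-all : ∀ {x} ys → All.All (x ≤ₒ_) ys → insert x ys ≡ x ∷ ys
  insert-≤-all     []       _           = refl
  insert-≤-all {x} (y ∷ ys) (x≤y All.∷ _) with x ≤? y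
  ... | yes _   = refl
  ... | no x≰y = ⊥-elim (x≰y x≤y)

  filter-insert-∉ : ∀ {x} → ¬ P x → ∀ ys → filter P? (insert x ys) ≡ filter P? ys
  filter-insert-∉ {x} ¬px []       = filter-reject P? ¬px
  filter-insert-∉ {x} ¬px (y ∷ ys) with does (x ≤? y)
  ... | true  = filter-reject P? ¬px
  ... | false with does (P? y)
  ...   | true  = cong (y ∷_) (filter-insert-∉ ¬px ys)
  ...   | false = filter-insert-∉ ¬px ys

  filter-insert-∈ : ∀ {x} → P x → ∀ {ys} → Sorted ys →
    filter P? (insert x ys) ≡ insert x (filter P? ys)
  filter-insert-∈ {x} px {[]} _ = filter-accept P? px
  filter-insert-∈ {x} px {y ∷ ys} ys↗ with x ≤? y
  ... | yes x≤y = trans (filter-accept P? px)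
    (≡.sym (insert-≤-all (filter P? (y ∷ ys)) (All.filter⁺ P? (Linked⇒All ≤ₒ-trans x≤y ys↗))))
  ... | no x≰y with does (P? y)
  ...   | false = filter-insert-∈ px (Linked.tail ys↗)
  ...   | true  with x ≤? y
  ...     | yes x≤y = ⊥-elim (x≰y x≤y)
  ...     | no _    = cong (y ∷_) (filter-insert-∈ px (Linked.tail ys↗))

  filter-sort : ∀ xs → filter P? (sort xs) ≡ sort (filter P? xs)
  filter-sort []       = refl
  filter-sort (x ∷ xs) with P? x
  ... | yes px  = trans (filter-insert-∈ px (sort-↗ xs)) (cong (insert x) (filter-sort xs))
  ... | no ¬px = trans (filter-insert-∉ ¬px (sort xs)) (filter-sort xs)

complement : BinWord → BinWord
complement = map not

-- Occurrences are numbered from 0: Before w t s says that the t-th 0 of w comes before its s-th 1.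
Before : BinWord → ℕ → ℕ → Set
Before []          t       s       = ⊥
Before (false ∷ w) zero    s       = ⊤
Before (false ∷ w) (suc t) s       = Before w t s
Before (true ∷ w)  t       zero    = ⊥
Before (true ∷ w)  t       (suc s) = Before w t s

-- Track k uses occurrences 2k and 2k+1 of each letter (δ_{k+1,k+1} in the paper's numbering);
-- TrackMeets k w says that the span of those two 0s overlaps the span of those two 1s.
TrackMeets : ℕ → BinWord → Set
TrackMeets k w = ¬ Before w (suc (k + k)) (k + k) × ¬ Before (complement w) (suc (k + k)) (k + k)

complement-involutive : ∀ w → complement (complement w) ≡ w
complement-involutive []          = refl
complement-involutive (false ∷ w) = cong (false ∷_) (complement-involutive w)
complement-involutive (true ∷ w)  = cong (true ∷_) (complement-involutive w)

occ-complement : ∀ b w → occ b (complement w) ≡ occ (not b) w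
occ-complement b     []          = refl
occ-complement false (false ∷ w) = occ-complement false w
occ-complement false (true ∷ w)  = cong suc (occ-complement false w)
occ-complement true  (false ∷ w) = cong suc (occ-complement true w)
occ-complement true  (true ∷ w)  = occ-complement true w

complement-uniform : ∀ {k w} → IsUniformWord k w → IsUniformWord k (complement w)
complement-uniform {w = w} (occ₀ , occ₁) =
  trans (occ-complement false w) occ₁ , trans (occ-complement true w) occ₀

TrackMeets-complement : ∀ k w → TrackMeets k (complement w) ⇔ TrackMeets k w
TrackMeets-complement k w = mk⇔ (λ (p , q) → subst ¬Before (complement-involutive w) q , p)
                                (λ (p , q) → q , subst ¬Before (≡.sym (complement-involutive w)) p)
  where
  ¬Before : BinWord → Set
  ¬Before v = ¬ Before v (suc (k + k)) (k + k)

-- δaux K c₀ c₁ has already read c₀ 0s and c₁ 1s; kept K c says whether it keeps the next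
-- occurrence of a letter read c times so far.
kept : ℕ → ℕ → Bool
kept K c = (suc c ≡ᵇ 2 * K ∸ 1) ∨ (suc c ≡ᵇ 2 * K)

keptCount : ℕ → ℕ → ℕ → ℕ
keptCount K c zero    = zero
keptCount K c (suc t) = if kept K c then suc (keptCount K (suc c) t) else keptCount K (suc c) t

Before-δaux : ∀ K c₀ c₁ w t s → kept K (c₀ + t) ≡ true → kept K (c₁ + s) ≡ true →
  Before w t s ⇔ Before (δaux K c₀ c₁ w) (keptCount K c₀ t) (keptCount K c₁ s)
Before-δaux K c₀ c₁ []          t       s       _  _  = ⇔-id _
Before-δaux K c₀ c₁ (false ∷ w) zero    s       k₀ _
  rewrite +-identityʳ c₀ | k₀ = mk⇔ (λ _ → tt) (λ _ → tt)
Before-δaux K c₀ c₁ (false ∷ w) (suc t) s       k₀ k₁ with kept K c₀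
... | true  = Before-δaux K (suc c₀) c₁ w t s (trans (cong (kept K) (≡.sym (+-suc c₀ t))) k₀) k₁
... | false = Before-δaux K (suc c₀) c₁ w t s (trans (cong (kept K) (≡.sym (+-suc c₀ t))) k₀) k₁
Before-δaux K c₀ c₁ (true ∷ w)  t       zero    _  k₁
  rewrite +-identityʳ c₁ | k₁ = mk⇔ (λ ()) (λ ())
Before-δaux K c₀ c₁ (true ∷ w)  t       (suc s) k₀ k₁ with kept K c₁
... | true  = Before-δaux K c₀ (suc c₁) w t s k₀ (trans (cong (kept K) (≡.sym (+-suc c₁ s))) k₁)
... | false = Before-δaux K c₀ (suc c₁) w t s k₀ (trans (cong (kept K) (≡.sym (+-suc c₁ s))) k₁)

δaux-complement : ∀ K c₀ c₁ w → δaux K c₀ c₁ (complement w) ≡ complement (δaux K c₁ c₀ w)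
δaux-complement K c₀ c₁ []          = refl
δaux-complement K c₀ c₁ (false ∷ w) with kept K c₁
... | true  = cong (true ∷_) (δaux-complement K c₀ (suc c₁) w)
... | false = δaux-complement K c₀ (suc c₁) w
δaux-complement K c₀ c₁ (true ∷ w)  with kept K c₀
... | true  = cong (false ∷_) (δaux-complement K (suc c₀) c₁ w)
... | false = δaux-complement K (suc c₀) c₁ w

occ-false-δaux : ∀ K c₀ c₁ w → occ false (δaux K c₀ c₁ w) ≡ keptCount K c₀ (occ false w)
occ-false-δaux K c₀ c₁ []          = refl
occ-false-δaux K c₀ c₁ (false ∷ w) with kept K c₀
... | true  = cong suc (occ-false-δaux K (suc c₀) c₁ w)
... | false = occ-false-δaux K (suc c₀) c₁ w
occ-false-δaux K c₀ c₁ (true ∷ w)  with kept K c₁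
... | true  = occ-false-δaux K c₀ (suc c₁) w
... | false = occ-false-δaux K c₀ (suc c₁) w

occ-true-δaux : ∀ K c₀ c₁ w → occ true (δaux K c₀ c₁ w) ≡ keptCount K c₁ (occ true w)
occ-true-δaux K c₀ c₁ w = begin
  occ true d                                ≡⟨ cong (occ true) (complement-involutive d) ⟨
  occ true (complement (complement d))      ≡⟨ occ-complement true (complement d) ⟩
  occ false (complement d)                  ≡⟨ cong (occ false) (δaux-complement K c₁ c₀ w) ⟨
  occ false (δaux K c₁ c₀ (complement w))   ≡⟨ occ-false-δaux K c₁ c₀ (complement w) ⟩
  keptCount K c₁ (occ false (complement w)) ≡⟨ cong (keptCount K c₁) (occ-complement false w) ⟩
  keptCount K c₁ (occ true w)               ∎
  where
  open ≡-Reasoning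
  d : BinWord
  d = δaux K c₀ c₁ w

kept-suc : ∀ k c → kept (suc k) c ≡ (c ≡ᵇ k + k) ∨ (c ≡ᵇ suc (k + k))
kept-suc k c rewrite +-identityʳ k | +-suc k k = refl

≡ᵇ-true : ∀ {m n} → m ≡ n → (m ≡ᵇ n) ≡ true
≡ᵇ-true {m} {n} m≡n = Equivalence.to Bool.T-≡ (≡⇒≡ᵇ m n m≡n)

≡ᵇ-false : ∀ {m n} → m ≢ n → (m ≡ᵇ n) ≡ false
≡ᵇ-false {m} {n} m≢n = Bool.¬-not (λ eq → m≢n (≡ᵇ⇒≡ m n (Equivalence.from Bool.T-≡ eq)))

kept-first : ∀ k → kept (suc k) (k + k) ≡ true
kept-first k rewrite kept-suc k (k + k) | ≡ᵇ-true {k + k} refl = refl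

kept-second : ∀ k → kept (suc k) (suc (k + k)) ≡ true
kept-second k rewrite kept-suc k (suc (k + k)) | ≡ᵇ-true {suc (k + k)} refl = Bool.∨-zeroʳ _

kept-other : ∀ k c → c ≢ k + k → c ≢ suc (k + k) → kept (suc k) c ≡ false
kept-other k c ≢first ≢second rewrite kept-suc k c | ≡ᵇ-false ≢first | ≡ᵇ-false ≢second = refl

kept-below : ∀ k c → c < k + k → kept (suc k) c ≡ false
kept-below k c c<2k = kept-other k c (<⇒≢ c<2k) (<⇒≢ (m<n⇒m<1+n c<2k))

kept-above : ∀ k c → suc (suc (k + k)) ≤ c → kept (suc k) c ≡ false
kept-above k c 2k+2≤c = kept-other k c (>⇒≢ (<-trans (n<1+n _) 2k+2≤c)) (>⇒≢ 2k+2≤c)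

keptCount-+ : ∀ K c a b → keptCount K c (a + b) ≡ keptCount K c a + keptCount K (c + a) b
keptCount-+ K c zero    b rewrite +-identityʳ c = refl
keptCount-+ K c (suc a) b rewrite +-suc c a with kept K c
... | true  = cong suc (keptCount-+ K (suc c) a b)
... | false = keptCount-+ K (suc c) a b

keptCount-below : ∀ k c t → c + t ≤ k + k → keptCount (suc k) c t ≡ 0
keptCount-below k c zero    _ = refl
keptCount-below k c (suc t) c+t<2k rewrite kept-below k c (<-≤-trans (m<m+n c z<s) c+t<2k)
  = keptCount-below k (suc c) t (≤-trans (≤-reflexive (≡.sym (+-suc c t))) c+t<2k)

keptCount-above : ∀ k c t → suc (suc (k + k)) ≤ c → keptCount (suc k) c t ≡ 0
keptCount-above k c zero    _ = refl
keptCount-above k c (suc t) 2k+2≤c rewrite kept-above k c 2k+2≤c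
  = keptCount-above k (suc c) t (m≤n⇒m≤1+n 2k+2≤c)

keptCount-first : ∀ k → keptCount (suc k) 0 (k + k) ≡ 0
keptCount-first k = keptCount-below k 0 (k + k) ≤-refl

keptCount-pair : ∀ k t → keptCount (suc k) (k + k) (suc (suc t)) ≡ 2
keptCount-pair k t rewrite kept-first k | kept-second k
  = cong (λ x → suc (suc x)) (keptCount-above k (suc (suc (k + k))) t ≤-refl)

keptCount-second : ∀ k → keptCount (suc k) 0 (suc (k + k)) ≡ 1
keptCount-second k = begin
  keptCount (suc k) 0 (suc (k + k))                         ≡⟨ cong (keptCount (suc k) 0) (+-comm 1 (k + k)) ⟩
  keptCount (suc k) 0 (k + k + 1)                           ≡⟨ keptCount-+ (suc k) 0 (k + k) 1 ⟩
  keptCount (suc k) 0 (k + k) + keptCount (suc k) (k + k) 1 ≡⟨ cong (_+ keptCount (suc k) (k + k) 1)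
                                                                     (keptCount-first k) ⟩
  keptCount (suc k) (k + k) 1                               ≡⟨ cong (λ b → if b then 1 else 0) (kept-first k) ⟩
  1                                                         ∎
  where open ≡-Reasoning

keptCount-all : ∀ k t → suc (suc (k + k)) ≤ t → keptCount (suc k) 0 t ≡ 2
keptCount-all k t 2k+2≤t with m≤n⇒∃[o]m+o≡n 2k+2≤t
... | r , refl = begin
  keptCount (suc k) 0 (suc (suc (k + k)) + r)
    ≡⟨ cong (keptCount (suc k) 0) 2k+2+r≡2k+[2+r] ⟩
  keptCount (suc k) 0 (k + k + suc (suc r))
    ≡⟨ keptCount-+ (suc k) 0 (k + k) (suc (suc r)) ⟩
  keptCount (suc k) 0 (k + k) + keptCount (suc k) (k + k) (suc (suc r))
    ≡⟨ cong₂ _+_ (keptCount-first k) (keptCount-pair k r) ⟩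
  2 ∎
  where
  open ≡-Reasoning
  2k+2+r≡2k+[2+r] : suc (suc (k + k)) + r ≡ k + k + suc (suc r)
  2k+2+r≡2k+[2+r] = ≡.sym (trans (+-suc (k + k) (suc r)) (cong suc (+-suc (k + k) r)))

length-uniform : ∀ {k} w → IsUniformWord k w → length w ≡ k + k
length-uniform w (refl , occ-true≡k) = trans (≡.sym (occs w)) (cong (occ false w +_) occ-true≡k)
  where
  occs : ∀ w → occ false w + occ true w ≡ length w
  occs []          = refl
  occs (false ∷ w) = cong suc (occs w)
  occs (true ∷ w)  = trans (+-suc (occ false w) (occ true w)) (cong suc (occs w))

∈TrackPatterns⇒TrackMeets₀ : ∀ {d} → d ∈ TrackPatterns → TrackMeets 0 d
∈TrackPatterns⇒TrackMeets₀ (here refl)                         = (λ ()) , (λ ())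
∈TrackPatterns⇒TrackMeets₀ (there (here refl))                 = (λ ()) , (λ ())
∈TrackPatterns⇒TrackMeets₀ (there (there (here refl)))         = (λ ()) , (λ ())
∈TrackPatterns⇒TrackMeets₀ (there (there (there (here refl)))) = (λ ()) , (λ ())

TrackMeets₀⇒∈TrackPatterns : ∀ d → length d ≡ 4 → IsUniformWord 2 d → TrackMeets 0 d →
  d ∈ TrackPatterns
TrackMeets₀⇒∈TrackPatterns (false ∷ false ∷ false ∷ false ∷ []) _ (() , _)
TrackMeets₀⇒∈TrackPatterns (false ∷ false ∷ false ∷ true  ∷ []) _ (() , _)
TrackMeets₀⇒∈TrackPatterns (false ∷ false ∷ true  ∷ false ∷ []) _ (() , _)
TrackMeets₀⇒∈TrackPatterns (false ∷ false ∷ true  ∷ true  ∷ []) _ _ (¬0011 , _) = ⊥-elim (¬0011 tt)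
TrackMeets₀⇒∈TrackPatterns (false ∷ true  ∷ false ∷ false ∷ []) _ (() , _)
TrackMeets₀⇒∈TrackPatterns (false ∷ true  ∷ false ∷ true  ∷ []) _ _ _ = here refl
TrackMeets₀⇒∈TrackPatterns (false ∷ true  ∷ true  ∷ false ∷ []) _ _ _ = there (there (here refl))
TrackMeets₀⇒∈TrackPatterns (false ∷ true  ∷ true  ∷ true  ∷ []) _ (_ , ())
TrackMeets₀⇒∈TrackPatterns (true  ∷ false ∷ false ∷ false ∷ []) _ (() , _)
TrackMeets₀⇒∈TrackPatterns (true  ∷ false ∷ false ∷ true  ∷ []) _ _ _ = there (there (there (here refl)))
TrackMeets₀⇒∈TrackPatterns (true  ∷ false ∷ true  ∷ false ∷ []) _ _ _ = there (here refl)
TrackMeets₀⇒∈TrackPatterns (true  ∷ false ∷ true  ∷ true  ∷ []) _ (_ , ())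
TrackMeets₀⇒∈TrackPatterns (true  ∷ true  ∷ false ∷ false ∷ []) _ _ (_ , ¬1100) = ⊥-elim (¬1100 tt)
TrackMeets₀⇒∈TrackPatterns (true  ∷ true  ∷ false ∷ true  ∷ []) _ (_ , ())
TrackMeets₀⇒∈TrackPatterns (true  ∷ true  ∷ true  ∷ false ∷ []) _ (_ , ())
TrackMeets₀⇒∈TrackPatterns (true  ∷ true  ∷ true  ∷ true  ∷ []) _ (_ , ())
TrackMeets₀⇒∈TrackPatterns []                               ()
TrackMeets₀⇒∈TrackPatterns (_ ∷ [])                         ()
TrackMeets₀⇒∈TrackPatterns (_ ∷ _ ∷ [])                     ()
TrackMeets₀⇒∈TrackPatterns (_ ∷ _ ∷ _ ∷ [])                 ()
TrackMeets₀⇒∈TrackPatterns (_ ∷ _ ∷ _ ∷ _ ∷ _ ∷ _)          ()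

∈TrackPatterns⇔TrackMeets₀ : ∀ d → IsUniformWord 2 d → d ∈ TrackPatterns ⇔ TrackMeets 0 d
∈TrackPatterns⇔TrackMeets₀ d u =
  mk⇔ ∈TrackPatterns⇒TrackMeets₀ (TrackMeets₀⇒∈TrackPatterns d (length-uniform d u) u)

Before-δkk : ∀ k w → Before w (suc (k + k)) (k + k) ⇔ Before (δkk (suc k) w) 1 0
Before-δkk k w =
  subst₂ (λ t s → Before w (suc (k + k)) (k + k) ⇔ Before (δkk (suc k) w) t s)
         (keptCount-second k) (keptCount-first k)
         (Before-δaux (suc k) 0 0 w (suc (k + k)) (k + k) (kept-second k) (kept-first k))

2k+2≤2ℓ : ∀ {k ℓ} → k < ℓ → suc (suc (k + k)) ≤ 2 * ℓ
2k+2≤2ℓ {k} {ℓ} k<ℓ = begin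
  suc (suc (k + k)) ≡⟨ cong suc (+-suc k k) ⟨
  suc k + suc k     ≤⟨ +-mono-≤ k<ℓ k<ℓ ⟩
  ℓ + ℓ             ≡⟨ cong (ℓ +_) (+-identityʳ ℓ) ⟨
  2 * ℓ             ∎
  where open ≤-Reasoning

δkk-uniform : ∀ {ℓ} k w → k < ℓ → IsUniformWord (2 * ℓ) w → IsUniformWord 2 (δkk (suc k) w)
δkk-uniform k w k<ℓ (occ₀ , occ₁) =
  trans (occ-false-δaux (suc k) 0 0 w) (keptCount-all k _ (subst (_ ≤_) (≡.sym occ₀) (2k+2≤2ℓ k<ℓ))) ,
  trans (occ-true-δaux (suc k) 0 0 w) (keptCount-all k _ (subst (_ ≤_) (≡.sym occ₁) (2k+2≤2ℓ k<ℓ)))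

δkk∈TrackPatterns⇔TrackMeets : ∀ {ℓ} k w → k < ℓ → IsUniformWord (2 * ℓ) w →
  δkk (suc k) w ∈ TrackPatterns ⇔ TrackMeets k w
δkk∈TrackPatterns⇔TrackMeets k w k<ℓ u =
  (¬-cong-⇔ (⇔-sym (Before-δkk k w)) ×-⇔ ¬-cong-⇔ (⇔-sym Before-complement))
    ⇔-∘ ∈TrackPatterns⇔TrackMeets₀ (δkk (suc k) w) (δkk-uniform k w k<ℓ u)
  where
  Before-complement : Before (complement w) (suc (k + k)) (k + k) ⇔ Before (complement (δkk (suc k) w)) 1 0
  Before-complement = subst (λ v → Before (complement w) (suc (k + k)) (k + k) ⇔ Before v 1 0)
                            (δaux-complement (suc k) 0 0 w) (Before-δkk k (complement w))

Ltrk⇔∃TrackMeets : ∀ ℓ w →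
  Ltrk ℓ w ⇔ (IsUniformWord (2 * ℓ) w × ∃ λ (i : Fin ℓ) → TrackMeets (toℕ i) w)
Ltrk⇔∃TrackMeets ℓ w = mk⇔
  (λ { (occ₀ , occ₁ , suc k , _ , k<ℓ , δ∈) →
         (occ₀ , occ₁) , fromℕ< k<ℓ ,
         subst (λ j → TrackMeets j w) (≡.sym (toℕ-fromℕ< k<ℓ))
               (Equivalence.to (δkk∈TrackPatterns⇔TrackMeets k w k<ℓ (occ₀ , occ₁)) δ∈) })
  (λ ((occ₀ , occ₁) , i , meets) →
    occ₀ , occ₁ , suc (toℕ i) , s≤s z≤n , toℕ<n i ,
    Equivalence.from (δkk∈TrackPatterns⇔TrackMeets (toℕ i) w (toℕ<n i) (occ₀ , occ₁)) meets)

occ-++ : ∀ b p q → occ b (p ++ q) ≡ occ b p + occ b q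
occ-++ b     []          q = refl
occ-++ false (false ∷ p) q = cong suc (occ-++ false p q)
occ-++ false (true ∷ p)  q = occ-++ false p q
occ-++ true  (false ∷ p) q = occ-++ true p q
occ-++ true  (true ∷ p)  q = cong suc (occ-++ true p q)

Before-++ˡ : ∀ p q t s → t < occ false p → s < occ true p → Before (p ++ q) t s ⇔ Before p t s
Before-++ˡ (false ∷ p) q zero    s _             _             = ⇔-id _
Before-++ˡ (false ∷ p) q (suc t) s (s≤s t<occ)   s<occ         = Before-++ˡ p q t s t<occ s<occ
Before-++ˡ (true ∷ p)  q t       zero _          _             = ⇔-id _
Before-++ˡ (true ∷ p)  q t       (suc s) t<occ   (s≤s s<occ)   = Before-++ˡ p q t s t<occ s<occ

Before-++ʳ : ∀ p q t s → Before (p ++ q) (occ false p + t) (occ true p + s) ⇔ Before q t s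
Before-++ʳ []          q t s = ⇔-id _
Before-++ʳ (false ∷ p) q t s = Before-++ʳ p q t s
Before-++ʳ (true ∷ p)  q t s = Before-++ʳ p q t s

occ-concat : ∀ b {ℓ} (Bs : Fin ℓ → BinWord) → (∀ j → occ b (Bs j) ≡ 2) →
  occ b (concat (tabulate Bs)) ≡ 2 * ℓ
occ-concat b {zero}  Bs occ≡2 = refl
occ-concat b {suc ℓ} Bs occ≡2 = begin
  occ b (Bs Fin.zero ++ rest)      ≡⟨ occ-++ b (Bs Fin.zero) rest ⟩
  occ b (Bs Fin.zero) + occ b rest ≡⟨ cong₂ _+_ (occ≡2 Fin.zero) (occ-concat b _ (occ≡2 ∘ Fin.suc)) ⟩
  2 + 2 * ℓ                        ≡⟨ *-suc 2 ℓ ⟨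
  2 * suc ℓ                        ∎
  where
  open ≡-Reasoning
  rest : BinWord
  rest = concat (tabulate (Bs ∘ Fin.suc))

concat-uniform : ∀ {ℓ} (Bs : Fin ℓ → BinWord) → (∀ j → IsUniformWord 2 (Bs j)) →
  IsUniformWord (2 * ℓ) (concat (tabulate Bs))
concat-uniform Bs uniform = occ-concat false Bs (proj₁ ∘ uniform) , occ-concat true Bs (proj₂ ∘ uniform)

Before-concat : ∀ {ℓ} (Bs : Fin ℓ → BinWord) → (∀ j → IsUniformWord 2 (Bs j)) → ∀ i →
  Before (concat (tabulate Bs)) (suc (toℕ i + toℕ i)) (toℕ i + toℕ i) ⇔ Before (Bs i) 1 0
Before-concat Bs uniform Fin.zero = Before-++ˡ (Bs Fin.zero) _ 1 0
  (subst (1 <_) (≡.sym (proj₁ (uniform Fin.zero))) (s≤s (s≤s z≤n)))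
  (subst (0 <_) (≡.sym (proj₂ (uniform Fin.zero))) (s≤s z≤n))
Before-concat Bs uniform (Fin.suc i) =
  Before-concat (Bs ∘ Fin.suc) (uniform ∘ Fin.suc) i ⇔-∘
  subst₂ (λ t s → Before (Bs Fin.zero ++ rest) t s ⇔ Before rest (suc (k + k)) (k + k))
         (trans (cong (_+ suc (k + k)) occ₀) (cong (suc ∘ suc) (≡.sym (+-suc k k))))
         (trans (cong (_+ (k + k)) occ₁) (cong suc (≡.sym (+-suc k k))))
         (Before-++ʳ (Bs Fin.zero) rest (suc (k + k)) (k + k))
  where
  k : ℕ
  k = toℕ i
  rest : BinWord
  rest = concat (tabulate (Bs ∘ Fin.suc))
  occ₀ : occ false (Bs Fin.zero) ≡ 2
  occ₀ = proj₁ (uniform Fin.zero)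
  occ₁ : occ true (Bs Fin.zero) ≡ 2
  occ₁ = proj₂ (uniform Fin.zero)

complement-concat : ∀ {ℓ} (Bs : Fin ℓ → BinWord) →
  complement (concat (tabulate Bs)) ≡ concat (tabulate (complement ∘ Bs))
complement-concat Bs = trans (≡.sym (concat-map (tabulate Bs))) (cong concat (map-tabulate Bs (map not)))

TrackMeets-concat : ∀ {ℓ} (Bs : Fin ℓ → BinWord) → (∀ j → IsUniformWord 2 (Bs j)) → ∀ i →
  TrackMeets (toℕ i) (concat (tabulate Bs)) ⇔ TrackMeets 0 (Bs i)
TrackMeets-concat Bs uniform i =
  ¬-cong-⇔ (Before-concat Bs uniform i) ×-⇔
  ¬-cong-⇔ (subst (λ W → Before W (suc (k + k)) (k + k) ⇔ Before (complement (Bs i)) 1 0)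
                  (≡.sym (complement-concat Bs))
                  (Before-concat (complement ∘ Bs) (λ j → complement-uniform {w = Bs j} (uniform j)) i))
  where
  k : ℕ
  k = toℕ i

suc<suc⇔ : ∀ {m n} → m < n ⇔ suc m < suc n
suc<suc⇔ = mk⇔ s<s s<s⁻¹

module _ {m : ℕ} where

  label : Fin m → Fin m → Bool → Fin m
  label a b false = a
  label a b true  = b

  count : Fin m → List (Fin m) → ℕ
  count x []      = 0
  count x (z ∷ w) = if does (z Fin.≟ x) then suc (count x w) else count x w

  -- The index in w of the t-th occurrence of x, counted from 0; junk if x occurs at most t times.
  position : List (Fin m) → Fin m → ℕ → ℕ
  position []      x t       = 0
  position (z ∷ w) x t       with does (z Fin.≟ x)
  position (z ∷ w) x zero    | true  = 0
  position (z ∷ w) x (suc t) | true  = suc (position w x t)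
  position (z ∷ w) x t       | false = suc (position w x t)

  position<length : ∀ x w t → t < count x w → position w x t < length w
  position<length x (z ∷ w) t t<count with z Fin.≟ x
  position<length x (z ∷ w) zero    _             | yes _ = s≤s z≤n
  position<length x (z ∷ w) (suc t) (s≤s t<count) | yes _ = s≤s (position<length x w t t<count)
  position<length x (z ∷ w) t       t<count       | no _  = s≤s (position<length x w t t<count)

  position-mono : ∀ x w t → suc t < count x w → position w x t < position w x (suc t)
  position-mono x (z ∷ w) t t<count with z Fin.≟ x
  position-mono x (z ∷ w) zero    _             | yes _ = s≤s z≤n
  position-mono x (z ∷ w) (suc t) (s≤s t<count) | yes _ = s≤s (position-mono x w t t<count)
  position-mono x (z ∷ w) t       t<count       | no _  = s≤s (position-mono x w t t<count)

  Before-h⇔position< : ∀ {x y} w t s → x ≢ y → t < count x w → s < count y w →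
    Before (h x y w) t s ⇔ position w x t < position w y s
  Before-h⇔position< {x} {y} (z ∷ w) t s x≢y t<count s<count with z Fin.≟ x | z Fin.≟ y
  ... | yes refl | yes refl = ⊥-elim (x≢y refl)
  Before-h⇔position< (z ∷ w) zero    s       _   _              _              | yes _ | no _ =
    mk⇔ (λ _ → s≤s z≤n) (λ _ → tt)
  Before-h⇔position< (z ∷ w) (suc t) s       x≢y (s≤s t<count) s<count        | yes _ | no _ =
    suc<suc⇔ ⇔-∘ Before-h⇔position< w t s x≢y t<count s<count
  Before-h⇔position< (z ∷ w) t       zero    _   _              _              | no _  | yes _ =
    mk⇔ (λ ()) (λ ())
  Before-h⇔position< (z ∷ w) t       (suc s) x≢y t<count        (s≤s s<count) | no _  | yes _ =
    suc<suc⇔ ⇔-∘ Before-h⇔position< w t s x≢y t<count s<count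
  Before-h⇔position< (z ∷ w) t       s       x≢y t<count        s<count        | no _  | no _  =
    suc<suc⇔ ⇔-∘ Before-h⇔position< w t s x≢y t<count s<count

  occ-false-h : ∀ {x y : Fin m} w → x ≢ y → occ false (h x y w) ≡ count x w
  occ-false-h {x} {y} []      _   = refl
  occ-false-h {x} {y} (z ∷ w) x≢y with z Fin.≟ x | z Fin.≟ y
  ... | yes refl | yes refl = ⊥-elim (x≢y refl)
  ... | yes _    | no _     = cong suc (occ-false-h w x≢y)
  ... | no _     | yes _    = occ-false-h w x≢y
  ... | no _     | no _     = occ-false-h w x≢y

  h-swap : ∀ {x y : Fin m} w → x ≢ y → h y x w ≡ complement (h x y w)
  h-swap {x} {y} []      _   = refl
  h-swap {x} {y} (z ∷ w) x≢y with z Fin.≟ x | z Fin.≟ y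
  ... | yes refl | yes refl = ⊥-elim (x≢y refl)
  ... | yes _    | no _     = cong (true ∷_) (h-swap w x≢y)
  ... | no _     | yes _    = cong (false ∷_) (h-swap w x≢y)
  ... | no _     | no _     = h-swap w x≢y

  occ-true-h : ∀ {x y : Fin m} w → x ≢ y → occ true (h x y w) ≡ count y w
  occ-true-h {x} {y} w x≢y = begin
    occ true (h x y w)                           ≡⟨ cong (occ true) (complement-involutive (h x y w)) ⟨
    occ true (complement (complement (h x y w))) ≡⟨ occ-complement true (complement (h x y w)) ⟩
    occ false (complement (h x y w))             ≡⟨ cong (occ false) (h-swap w x≢y) ⟨
    occ false (h y x w)                          ≡⟨ occ-false-h w (≢-sym x≢y) ⟩
    count y w                                    ∎
    where open ≡-Reasoning

  h-label : ∀ {a b : Fin m} → a ≢ b → ∀ bs → h a b (map (label a b) bs) ≡ bs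
  h-label a≢b [] = refl
  h-label {a = a} {b} a≢b (false ∷ bs) with a Fin.≟ a
  ... | yes _ = cong (false ∷_) (h-label a≢b bs)
  ... | no a≢a = ⊥-elim (a≢a refl)
  h-label {a = a} {b} a≢b (true ∷ bs) with b Fin.≟ a | b Fin.≟ b
  ... | yes b≡a | _ = ⊥-elim (a≢b (≡.sym b≡a))
  ... | no _ | yes _ = cong (true ∷_) (h-label a≢b bs)
  ... | no _ | no b≢b = ⊥-elim (b≢b refl)

  h-skip : ∀ {u v z : Fin m} L → ¬ (z ≡ u ⊎ z ≡ v) → h u v (z ∷ L) ≡ h u v L
  h-skip {u = u} {v} {z} L z∉uv with z Fin.≟ u | z Fin.≟ v
  ... | yes z≡u | _       = ⊥-elim (z∉uv (inj₁ z≡u))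
  ... | no _    | yes z≡v = ⊥-elim (z∉uv (inj₂ z≡v))
  ... | no _    | no _    = refl

  h-∷-cong : ∀ {u v : Fin m} z L L′ → h u v L ≡ h u v L′ → h u v (z ∷ L) ≡ h u v (z ∷ L′)
  h-∷-cong {u = u} {v} z _ _ =
    cong (λ r → if does (z Fin.≟ u) then false ∷ r else if does (z Fin.≟ v) then true ∷ r else r)

  firstOneOf? : ∀ {B : Set} (u v : Fin m) → Decidable (λ (e : Fin m × B) → proj₁ e ≡ u ⊎ proj₁ e ≡ v)
  firstOneOf? u v = oneOf? Fin._≟_ u v ∘ proj₁

  h-filter : ∀ {B : Set} {u v : Fin m} (es : List (Fin m × B)) →
    h u v (map proj₁ es) ≡ h u v (map proj₁ (filter (firstOneOf? u v) es))
  h-filter [] = refl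
  h-filter {u = u} {v} ((z , b) ∷ es) with oneOf? Fin._≟_ u v z
  ... | yes z∈uv =
    trans (h-∷-cong z (map proj₁ es) (map proj₁ (filter (firstOneOf? u v) es)) (h-filter es))
          (cong (h u v ∘ map proj₁) (≡.sym (filter-accept (firstOneOf? u v) {z , b} z∈uv)))
  ... | no z∉uv  =
    trans (h-skip (map proj₁ es) z∉uv)
          (trans (h-filter es) (cong (h u v ∘ map proj₁) (≡.sym (filter-reject (firstOneOf? u v) {z , b} z∉uv))))

  h-++ : ∀ {u v : Fin m} p q → h u v (p ++ q) ≡ h u v p ++ h u v q
  h-++             []      q = refl
  h-++ {u = u} {v} (z ∷ p) q with z Fin.≟ u | z Fin.≟ v
  ... | yes _ | _     = cong (false ∷_) (h-++ p q)
  ... | no _  | yes _ = cong (true ∷_) (h-++ p q)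
  ... | no _  | no _  = h-++ p q

  h-concat : ∀ {ℓ} {u v : Fin m} (Ts : Fin ℓ → List (Fin m)) →
    h u v (concat (tabulate Ts)) ≡ concat (tabulate (h u v ∘ Ts))
  h-concat {ℓ = zero}  Ts = refl
  h-concat {ℓ = suc ℓ} Ts =
    trans (h-++ (Ts Fin.zero) _) (cong (h _ _ (Ts Fin.zero) ++_) (h-concat (Ts ∘ Fin.suc)))

toℚ : ℕ → ℚ
toℚ n = mkℚ (ℤ.+ n) 0 (Coprime.sym (Coprime.1-coprimeTo n))

toℚ-≤⇔ : ∀ {a b} → toℚ a ℚ.≤ toℚ b ⇔ a ≤ b
toℚ-≤⇔ {a} {b} = mk⇔
  (λ { (ℚ.*≤* a≤b) → ℤ.drop‿+≤+ (subst₂ ℤ._≤_ (a*1≡a a) (a*1≡a b) a≤b) })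
  (λ a≤b → ℚ.*≤* (subst₂ ℤ._≤_ (≡.sym (a*1≡a a)) (≡.sym (a*1≡a b)) (ℤ.+≤+ a≤b)))
  where
  a*1≡a : ∀ n → ℤ.+ n ℤ.* ℤ.+ 1 ≡ ℤ.+ n
  a*1≡a n = ℤ.*-identityʳ (ℤ.+ n)

natInterval : (a b : ℕ) → a ≤ b → Interval
natInterval a b a≤b = [ toℚ a , toℚ b ]⟨ Equivalence.from toℚ-≤⇔ a≤b ⟩

Meets⇔ : ∀ I J → Meets I J ⇔ (lo I ℚ.≤ hi J × lo J ℚ.≤ hi I)
Meets⇔ I J = mk⇔
  (λ (x , loI≤x , x≤hiI , loJ≤x , x≤hiJ) → ℚ.≤-trans loI≤x x≤hiJ , ℚ.≤-trans loJ≤x x≤hiI)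
  (λ (loI≤hiJ , loJ≤hiI) → witness loI≤hiJ loJ≤hiI (lo I ℚ.≤? lo J))
  where
  witness : lo I ℚ.≤ hi J → lo J ℚ.≤ hi I → Dec (lo I ℚ.≤ lo J) → Meets I J
  witness _       loJ≤hiI (yes loI≤loJ) = lo J , loI≤loJ , loJ≤hiI , ℚ.≤-refl , lo≤hi J
  witness loI≤hiJ _       (no loI≰loJ)  =
    lo I , ℚ.≤-refl , lo≤hi I , ℚ.<⇒≤ (ℚ.≰⇒> loI≰loJ) , loI≤hiJ

Meets-natInterval⇔ : ∀ {a b c d} (a≤b : a ≤ b) (c≤d : c ≤ d) →
  Meets (natInterval a b a≤b) (natInterval c d c≤d) ⇔ (a ≤ d × c ≤ b)
Meets-natInterval⇔ a≤b c≤d =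
  (toℚ-≤⇔ ×-⇔ toℚ-≤⇔) ⇔-∘ Meets⇔ (natInterval _ _ a≤b) (natInterval _ _ c≤d)

Meets-sym : ∀ I J → Meets I J → Meets J I
Meets-sym _ _ (x , loI≤x , x≤hiI , loJ≤x , x≤hiJ) = x , loJ≤x , x≤hiJ , loI≤x , x≤hiI

≮⇔≥ : ∀ {a b} → (¬ a < b) ⇔ b ≤ a
≮⇔≥ = mk⇔ ≮⇒≥ ≤⇒≯

-- From words to track graphs

module WordToTracks (ℓ : ℕ) {m : ℕ} (w : List (Fin m)) where

  Full : Fin m → Set
  Full x = count x w ≡ 2 * ℓ

  full? : ∀ x → Dec (Full x)
  full? x = count x w ≟ 2 * ℓ

  first : Fin ℓ → ℕ
  first i = toℕ i + toℕ i

  second<count : ∀ i {x} → Full x → suc (first i) < count x w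
  second<count i full = subst (_ ≤_) (≡.sym full) (2k+2≤2ℓ (toℕ<n i))

  first<count : ∀ i {x} → Full x → first i < count x w
  first<count i full = <-trans (n<1+n _) (second<count i full)

  first≤second : ∀ i {x} → Full x → position w x (first i) ≤ position w x (suc (first i))
  first≤second i {x} full = <⇒≤ (position-mono x w (first i) (second<count i full))

  -- Letters that are not full are isolated in G(Ltrk ℓ, w); they get pairwise distinct points to
  -- the right of every position of w.
  interval : Fin ℓ → (x : Fin m) → Dec (Full x) → Interval
  interval i x (yes full) = natInterval (position w x (first i)) (position w x (suc (first i)))
                                        (first≤second i full)
  interval i x (no _)     = natInterval (length w + toℕ x) (length w + toℕ x) ≤-refl

  TrackMeets⇔Meets : ∀ i {x y} → x ≢ y → (fx : Full x) (fy : Full y) →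
    TrackMeets (toℕ i) (h x y w) ⇔ Meets (interval i x (yes fx)) (interval i y (yes fy))
  TrackMeets⇔Meets i {x} {y} x≢y fx fy = begin
    TrackMeets (toℕ i) (h x y w)                          ≈⟨ ¬-cong-⇔ before-xy ×-⇔ ¬-cong-⇔ before-yx ⟩
    ((¬ hiˣ < loʸ) × (¬ hiʸ < loˣ))                       ≈⟨ ≮⇔≥ ×-⇔ ≮⇔≥ ⟩
    (loʸ ≤ hiˣ × loˣ ≤ hiʸ)                               ≈⟨ mk⇔ swap swap ⟩
    (loˣ ≤ hiʸ × loʸ ≤ hiˣ)                               ≈⟨ Meets-natInterval⇔ (first≤second i fx)
                                                                                 (first≤second i fy) ⟨
    Meets (interval i x (yes fx)) (interval i y (yes fy)) ∎
    where
    open ⇔-Reasoning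
    loˣ hiˣ loʸ hiʸ : ℕ
    loˣ = position w x (first i)
    hiˣ = position w x (suc (first i))
    loʸ = position w y (first i)
    hiʸ = position w y (suc (first i))
    before-xy : Before (h x y w) (suc (first i)) (first i) ⇔ hiˣ < loʸ
    before-xy = Before-h⇔position< w _ _ x≢y (second<count i fx) (first<count i fy)
    before-yx : Before (complement (h x y w)) (suc (first i)) (first i) ⇔ hiʸ < loˣ
    before-yx = subst (λ v → Before v (suc (first i)) (first i) ⇔ hiʸ < loˣ) (h-swap w x≢y)
                      (Before-h⇔position< w _ _ (≢-sym x≢y) (second<count i fy) (first<count i fx))

  isolated : ∀ i {x y} → x ≢ y → (¬fx : ¬ Full x) (dy : Dec (Full y)) →
    ¬ Meets (interval i x (no ¬fx)) (interval i y dy)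
  isolated i {x} {y} _ _ (yes fy) meets with Equivalence.to (Meets-natInterval⇔ ≤-refl (first≤second i fy)) meets
  ... | |w|+x≤hiʸ , _ =
    <⇒≱ (position<length y w _ (second<count i fy)) (≤-trans (m≤m+n (length w) (toℕ x)) |w|+x≤hiʸ)
  isolated i {x} {y} x≢y _ (no _) meets with Equivalence.to (Meets-natInterval⇔ ≤-refl ≤-refl) meets
  ... | x≤y , y≤x = x≢y (toℕ-injective (+-cancelˡ-≡ (length w) _ _ (≤-antisym x≤y y≤x)))

  Ltrk-h⇔∃Meets : ∀ {x y} (dx : Dec (Full x)) (dy : Dec (Full y)) → x ≢ y →
    Ltrk ℓ (h x y w) ⇔ ∃ λ i → Meets (interval i x dx) (interval i y dy)
  Ltrk-h⇔∃Meets {x} {y} (yes fx) (yes fy) x≢y = begin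
    Ltrk ℓ (h x y w)
      ≈⟨ Ltrk⇔∃TrackMeets ℓ (h x y w) ⟩
    (IsUniformWord (2 * ℓ) (h x y w) × ∃ λ i → TrackMeets (toℕ i) (h x y w))
      ≈⟨ mk⇔ proj₂ (uniform ,_) ⟩
    (∃ λ i → TrackMeets (toℕ i) (h x y w))
      ≈⟨ ∃-cong (λ {i} → TrackMeets⇔Meets i x≢y fx fy) ⟩
    (∃ λ i → Meets (interval i x (yes fx)) (interval i y (yes fy)))
      ∎
    where
    open ⇔-Reasoning
    uniform : IsUniformWord (2 * ℓ) (h x y w)
    uniform = trans (occ-false-h w x≢y) fx , trans (occ-true-h w x≢y) fy
  Ltrk-h⇔∃Meets (no ¬fx) dy x≢y = mk⇔
    (λ (occ₀ , _) → ⊥-elim (¬fx (trans (≡.sym (occ-false-h w x≢y)) occ₀)))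
    (λ (i , meets) → ⊥-elim (isolated i x≢y ¬fx dy meets))
  Ltrk-h⇔∃Meets {x} {y} (yes fx) (no ¬fy) x≢y = mk⇔
    (λ (_ , occ₁ , _) → ⊥-elim (¬fy (trans (≡.sym (occ-true-h w x≢y)) occ₁)))
    (λ (i , meets) → ⊥-elim (isolated i (≢-sym x≢y) ¬fy (yes fx)
                              (Meets-sym (interval i x (yes fx)) (interval i y (no ¬fy)) meets)))

InClass⇒IsTrackGraph : ∀ ℓ G → InClass (Ltrk ℓ) G → IsTrackGraph ℓ G
InClass⇒IsTrackGraph ℓ G (m , w , _ , f , adj⇔) = I , Adj⇔∃Meets
  where
  open WordToTracks ℓ w
  open Inverse f using (to; from; strictlyInverseˡ)

  I : Fin ℓ → Fin (n G) → Interval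
  I i v = interval i (from v) (full? (from v))

  Adj⇔∃Meets : ∀ u v → u ≢ v → Adj G u v ⇔ ∃ λ i → Meets (I i u) (I i v)
  Adj⇔∃Meets u v u≢v = begin
    Adj G u v                                          ≡⟨ cong₂ (Adj G) (strictlyInverseˡ u) (strictlyInverseˡ v) ⟨
    Adj G (to (from u)) (to (from v))                  ≈⟨ adj⇔ (from u) (from v) ⟨
    (from u ≢ from v × Ltrk ℓ (h (from u) (from v) w)) ≈⟨ mk⇔ proj₂ (from-u≢from-v ,_) ⟩
    Ltrk ℓ (h (from u) (from v) w)                     ≈⟨ Ltrk-h⇔∃Meets (full? _) (full? _) from-u≢from-v ⟩
    (∃ λ i → Meets (I i u) (I i v))                    ∎
    where
    open ⇔-Reasoning
    from-u≢from-v : from u ≢ from v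
    from-u≢from-v eq = u≢v (trans (≡.sym (strictlyInverseˡ u)) (trans (cong to eq) (strictlyInverseˡ v)))

-- From track graphs to words

module Endpoints {n : ℕ} (J : Fin n → Interval) where

  Endpoint : Set
  Endpoint = Fin n × Bool

  coordinate : Endpoint → ℚ
  coordinate (v , false) = lo (J v)
  coordinate (v , true)  = hi (J v)

  -- At equal coordinates left endpoints (false) come first, as closed intervals that touch meet.
  lexOrder : DecTotalOrder _ _ _
  lexOrder = On.decTotalOrder (Lex.×-decTotalOrder ℚ.≤-decTotalOrder Bool.≤-decTotalOrder)
                              (λ e → coordinate e , proj₂ e)

  -- Opaque so that the comparisons made by insertion sort stay visible in goals, where the proof
  -- of interleaving below case-splits on them.
  opaque
    _≼?_ : Decidable₂ (DecTotalOrder._≤_ lexOrder)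
    _≼?_ = DecTotalOrder._≤?_ lexOrder

  order : DecTotalOrder _ _ _
  order = record { isDecTotalOrder = record
    { isTotalOrder = DecTotalOrder.isTotalOrder lexOrder
    ; _≟_          = DecTotalOrder._≟_ lexOrder
    ; _≤?_         = _≼?_
    } }

  open DecTotalOrder order using (_≤?_) renaming (_≤_ to _≼_)
  open DecTotalOrderProperties order using (≰⇒≥)
  open InsertionSort order using (sort)

  ≼⇒≤ : ∀ {e f} → e ≼ f → coordinate e ℚ.≤ coordinate f
  ≼⇒≤ (inj₁ (e≤f , _)) = e≤f
  ≼⇒≤ (inj₂ (e≡f , _)) = ℚ.≤-reflexive e≡f

  ⋠⇒≥ : ∀ {e f} → ¬ e ≼ f → coordinate f ℚ.≤ coordinate e
  ⋠⇒≥ e⋠f = ≼⇒≤ (≰⇒≥ e⋠f)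

  right≼left⇒≰ : ∀ {u v} → (u , true) ≼ (v , false) → ¬ lo (J v) ℚ.≤ hi (J u)
  right≼left⇒≰ (inj₁ (hi≤lo , hi≢lo)) lo≤hi = hi≢lo (ℚ.≤-antisym hi≤lo lo≤hi)
  right≼left⇒≰ (inj₂ (_ , ()))

  left≼right : ∀ v → (v , false) ≼ (v , true)
  left≼right v with lo (J v) ℚ.≟ hi (J v)
  ... | yes lo≡hi = inj₂ (lo≡hi , f≤t)
  ... | no lo≢hi  = inj₁ (lo≤hi (J v) , lo≢hi)

  ends : Fin n → List Endpoint
  ends v = (v , false) ∷ (v , true) ∷ []

  record Interleaving (a b : Fin n) (bs : BinWord) : Set where
    field
      uniform          : IsUniformWord 2 bs
      TrackMeets⇔Meets : TrackMeets 0 bs ⇔ Meets (J a) (J b)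

  overlapping : ∀ {a b bs} → IsUniformWord 2 bs → TrackMeets 0 bs →
    lo (J a) ℚ.≤ hi (J b) → lo (J b) ℚ.≤ hi (J a) → Interleaving a b bs
  overlapping {a} {b} u t p q = record
    { uniform          = u
    ; TrackMeets⇔Meets = mk⇔ (λ _ → Equivalence.from (Meets⇔ (J a) (J b)) (p , q)) (λ _ → t)
    }

  separated : ∀ {a b bs} → IsUniformWord 2 bs → ¬ TrackMeets 0 bs →
    ¬ (lo (J a) ℚ.≤ hi (J b) × lo (J b) ℚ.≤ hi (J a)) → Interleaving a b bs
  separated {a} {b} u ¬t ¬pq = record
    { uniform          = u
    ; TrackMeets⇔Meets = mk⇔ (⊥-elim ∘ ¬t) (⊥-elim ∘ ¬pq ∘ Equivalence.to (Meets⇔ (J a) (J b)))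
    }

  -- Insertion sort of the four endpoints, one comparison at a time; bs records whether each
  -- endpoint in sorted order belongs to a (0) or to b (1).
  interleaving : ∀ a b → Σ BinWord λ bs →
    map proj₁ (sort (ends a ++ ends b)) ≡ map (label a b) bs × Interleaving a b bs
  interleaving a b with (b , false) ≤? (b , true)
  ... | no ⋠ = ⊥-elim (⋠ (left≼right b))
  ... | yes _ with (a , true) ≤? (b , false)
  ...   | yes hiᵃ≼loᵇ with (a , false) ≤? (a , true)
  ...     | no ⋠ = ⊥-elim (⋠ (left≼right a))
  ...     | yes _ = (false ∷ false ∷ true ∷ true ∷ []) , refl ,
    separated (refl , refl) (λ (¬0011 , _) → ¬0011 _) (right≼left⇒≰ hiᵃ≼loᵇ ∘ proj₂)
  interleaving a b | yes _ | no hiᵃ⋠loᵇ with (a , true) ≤? (b , true)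
  ...   | yes hiᵃ≼hiᵇ with (a , false) ≤? (b , false)
  ...     | yes loᵃ≼loᵇ = (false ∷ true ∷ false ∷ true ∷ []) , refl ,
    overlapping (refl , refl) ((λ ()) , (λ ()))
      (ℚ.≤-trans (≼⇒≤ loᵃ≼loᵇ) (lo≤hi (J b))) (⋠⇒≥ hiᵃ⋠loᵇ)
  ...     | no _ with (a , false) ≤? (a , true)
  ...       | no ⋠ = ⊥-elim (⋠ (left≼right a))
  ...       | yes _ = (true ∷ false ∷ false ∷ true ∷ []) , refl ,
    overlapping (refl , refl) ((λ ()) , (λ ()))
      (ℚ.≤-trans (lo≤hi (J a)) (≼⇒≤ hiᵃ≼hiᵇ)) (⋠⇒≥ hiᵃ⋠loᵇ)
  interleaving a b | yes _ | no hiᵃ⋠loᵇ | no _ with (a , false) ≤? (b , false)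
  ...     | yes loᵃ≼loᵇ = (false ∷ true ∷ true ∷ false ∷ []) , refl ,
    overlapping (refl , refl) ((λ ()) , (λ ()))
      (ℚ.≤-trans (≼⇒≤ loᵃ≼loᵇ) (lo≤hi (J b))) (⋠⇒≥ hiᵃ⋠loᵇ)
  ...     | no _ with (a , false) ≤? (b , true)
  ...       | yes loᵃ≼hiᵇ = (true ∷ false ∷ true ∷ false ∷ []) , refl ,
    overlapping (refl , refl) ((λ ()) , (λ ()))
      (≼⇒≤ loᵃ≼hiᵇ) (⋠⇒≥ hiᵃ⋠loᵇ)
  ...       | no loᵃ⋠hiᵇ with (a , false) ≤? (a , true)
  ...         | no ⋠ = ⊥-elim (⋠ (left≼right a))
  ...         | yes _ = (true ∷ true ∷ false ∷ false ∷ []) , refl ,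
    separated (refl , refl) (λ (_ , ¬1100) → ¬1100 _) (right≼left⇒≰ (≰⇒≥ loᵃ⋠hiᵇ) ∘ proj₁)

  filter-concatMap-ends : ∀ {u v} W →
    filter (firstOneOf? u v) (concatMap ends W) ≡ concatMap ends (filter (oneOf? Fin._≟_ u v) W)
  filter-concatMap-ends []      = refl
  filter-concatMap-ends {u} {v} (w ∷ W) with oneOf? Fin._≟_ u v w
  ... | yes w∈uv = begin
    filter (firstOneOf? u v) (ends w ++ concatMap ends W)
      ≡⟨ filter-accept (firstOneOf? u v) w∈uv ⟩
    (w , false) ∷ filter (firstOneOf? u v) ((w , true) ∷ concatMap ends W)
      ≡⟨ cong ((w , false) ∷_) (filter-accept (firstOneOf? u v) w∈uv) ⟩
    ends w ++ filter (firstOneOf? u v) (concatMap ends W)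
      ≡⟨ cong (ends w ++_) (filter-concatMap-ends W) ⟩
    concatMap ends (w ∷ filter (oneOf? Fin._≟_ u v) W)
      ≡⟨ cong (concatMap ends) (filter-accept (oneOf? Fin._≟_ u v) w∈uv) ⟨
    concatMap ends (filter (oneOf? Fin._≟_ u v) (w ∷ W))
      ∎
    where open ≡-Reasoning
  ... | no w∉uv = begin
    filter (firstOneOf? u v) (ends w ++ concatMap ends W)
      ≡⟨ filter-reject (firstOneOf? u v) w∉uv ⟩
    filter (firstOneOf? u v) ((w , true) ∷ concatMap ends W)
      ≡⟨ filter-reject (firstOneOf? u v) w∉uv ⟩
    filter (firstOneOf? u v) (concatMap ends W)
      ≡⟨ filter-concatMap-ends W ⟩
    concatMap ends (filter (oneOf? Fin._≟_ u v) W)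
      ≡⟨ cong (concatMap ends) (filter-reject (oneOf? Fin._≟_ u v) w∉uv) ⟨
    concatMap ends (filter (oneOf? Fin._≟_ u v) (w ∷ W))
      ∎
    where open ≡-Reasoning

  trackWord : List (Fin n)
  trackWord = map proj₁ (sort (concatMap ends (allFin n)))

  h-trackWord : ∀ {u v} → u ≢ v →
    h u v trackWord ≡ h u v (map proj₁ (sort (ends u ++ ends v))) ⊎
    h u v trackWord ≡ h u v (map proj₁ (sort (ends v ++ ends u)))
  h-trackWord {u} {v} u≢v =
    Sum.map (trans restricted ∘ cong sorted) (trans restricted ∘ cong sorted)
            (filter-oneOf Fin._≟_ (allFin⁺ n) (∈-allFin u) (∈-allFin v) u≢v)
    where
    sorted : List (Fin n) → List Bool
    sorted W = h u v (map proj₁ (sort (concatMap ends W)))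
    restricted : h u v trackWord ≡ sorted (filter (oneOf? Fin._≟_ u v) (allFin n))
    restricted = begin
      h u v trackWord
        ≡⟨ h-filter (sort (concatMap ends (allFin n))) ⟩
      h u v (map proj₁ (filter (firstOneOf? u v) (sort (concatMap ends (allFin n)))))
        ≡⟨ cong (h u v ∘ map proj₁) (filter-sort order (firstOneOf? u v) (concatMap ends (allFin n))) ⟩
      h u v (map proj₁ (sort (filter (firstOneOf? u v) (concatMap ends (allFin n)))))
        ≡⟨ cong (h u v ∘ map proj₁ ∘ sort) (filter-concatMap-ends (allFin n)) ⟩
      sorted (filter (oneOf? Fin._≟_ u v) (allFin n))
        ∎
      where open ≡-Reasoning

  Interleaving-complement : ∀ {a b bs} → Interleaving b a bs → Interleaving a b (complement bs)
  Interleaving-complement {a} {b} {bs} inter = record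
    { uniform          = complement-uniform {w = bs} (Interleaving.uniform inter)
    ; TrackMeets⇔Meets =
        Meets-sym⇔ ⇔-∘ (Interleaving.TrackMeets⇔Meets inter ⇔-∘ TrackMeets-complement 0 bs)
    }
    where
    Meets-sym⇔ : Meets (J b) (J a) ⇔ Meets (J a) (J b)
    Meets-sym⇔ = mk⇔ (Meets-sym (J b) (J a)) (Meets-sym (J a) (J b))

  trackWord-interleaving : ∀ {u v} → u ≢ v → Interleaving u v (h u v trackWord)
  trackWord-interleaving {u} {v} u≢v with h-trackWord u≢v
  ... | inj₁ eq = let bs , sorted≡ , inter = interleaving u v in
    subst (Interleaving u v) (≡.sym (trans eq (trans (cong (h u v) sorted≡) (h-label u≢v bs)))) inter
  ... | inj₂ eq = let bs , sorted≡ , inter = interleaving v u in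
    subst (Interleaving u v)
          (≡.sym (trans eq (trans (cong (h u v) sorted≡)
                 (trans (h-swap (map (label v u) bs) (≢-sym u≢v)) (cong complement (h-label (≢-sym u≢v) bs))))))
          (Interleaving-complement inter)

IsTrackGraph⇒InClass : ∀ ℓ → 1 ≤ ℓ → ∀ G → IsTrackGraph ℓ G → InClass (Ltrk ℓ) G
IsTrackGraph⇒InClass ℓ@(suc _) _ G (I , Adj⇔∃Meets) = n G , w , covers , ↔-id _ , Ltrk⇔Adj
  where
  track : Fin ℓ → List (Fin (n G))
  track i = Endpoints.trackWord (I i)

  w : List (Fin (n G))
  w = concat (tabulate track)

  covers : ∀ x → x ∈ w
  covers x = ∈-++⁺ˡ (∈-map⁺ proj₁ (∈-resp-↭ (↭-sym (InsertionSortₚ.sort-↭ order _)) x∈ends))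
    where
    open Endpoints (I Fin.zero) using (order; ends)
    x∈ends : (x , false) ∈ concatMap ends (allFin (n G))
    x∈ends = ∈-concatMap⁺ ends (Any.map (λ { refl → here refl }) (∈-allFin x))

  Ltrk-h⇔∃Meets : ∀ {u v} → u ≢ v → Ltrk ℓ (h u v w) ⇔ ∃ λ i → Meets (I i u) (I i v)
  Ltrk-h⇔∃Meets {u} {v} u≢v = begin
    Ltrk ℓ (h u v w)                    ≡⟨ cong (Ltrk ℓ) (h-concat track) ⟩
    Ltrk ℓ W                            ≈⟨ Ltrk⇔∃TrackMeets ℓ W ⟩
    (IsUniformWord (2 * ℓ) W × ∃ λ i → TrackMeets (toℕ i) W)
                                        ≈⟨ mk⇔ proj₂ (concat-uniform pairWord uniform ,_) ⟩
    (∃ λ i → TrackMeets (toℕ i) W)      ≈⟨ ∃-cong (λ {i} → TrackMeets-concat pairWord uniform i) ⟩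
    (∃ λ i → TrackMeets 0 (pairWord i)) ≈⟨ ∃-cong (Interleaving.TrackMeets⇔Meets (interleaving _)) ⟩
    (∃ λ i → Meets (I i u) (I i v))     ∎
    where
    open ⇔-Reasoning
    open Endpoints using (Interleaving)
    pairWord : Fin ℓ → BinWord
    pairWord i = h u v (track i)
    W : BinWord
    W = concat (tabulate pairWord)
    interleaving : ∀ i → Interleaving (I i) u v (pairWord i)
    interleaving i = Endpoints.trackWord-interleaving (I i) u≢v
    uniform : ∀ i → IsUniformWord 2 (pairWord i)
    uniform i = Interleaving.uniform (interleaving i)

  Ltrk⇔Adj : ∀ u v → (u ≢ v × Ltrk ℓ (h u v w)) ⇔ Adj G u v
  Ltrk⇔Adj u v with u Fin.≟ v
  ... | yes refl = mk⇔ (λ (u≢u , _) → ⊥-elim (u≢u refl)) (⊥-elim ∘ irrefl G)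
  ... | no u≢v   = ⇔-sym (Adj⇔∃Meets u v u≢v) ⇔-∘ (Ltrk-h⇔∃Meets u≢v ⇔-∘ mk⇔ proj₂ (u≢v ,_))

theorem3 : (ℓ : ℕ) → 1 ≤ ℓ →
    IsUniformLang (2 * ℓ) (Ltrk ℓ) ×
    ((G : Graph) → InClass (Ltrk ℓ) G ⇔ IsTrackGraph ℓ G)
theorem3 ℓ 1≤ℓ =
  (λ w → proj₁ ∘ Equivalence.to (Ltrk⇔∃TrackMeets ℓ w)) ,
  (λ G → mk⇔ (InClass⇒IsTrackGraph ℓ G) (IsTrackGraph⇒InClass ℓ 1≤ℓ G))
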